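{- Let $G$ be a cactus. Then the dispensing number $\vartheta(G)$ equals the number of odd cycles in $G$.
   Context: A cactus is a connected graph in which any two simple cycles have at most one vertex in common (so the cycles are edge-disjoint). An integer additive set-indexer (IASI) of a graph $G$ is an injective map $f:V(G)\to\mathcal{P}(\mathbb{N}_0)$ (finite subsets of non-negative integers) such that $f^+(uv)=f(u)+f(v)=\{a+b:a\in f(u),b\in f(v)\}$ is injective on $E(G)$. An AP-set is a set of at least three non-negative integers in arithmetic progression; its common difference is its deterministic index. An arithmetic IASI is an IASI for which all vertex and edge set-labels are AP-sets. For an edge, the integer ratio between the deterministic indices of its end vertices (larger over smaller) is its deterministic ratio. The dispensing number $\vartheta(G)$ is the minimum possible number of edges of $G$ that do not have a prime deterministic ratio (minimum over arithmetic IASIs of $G$). -}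

module Defs where

open import Data.Nat using (ℕ; zero; suc; _+_; _*_; _≤_; _<_)
open import Data.Nat.Primality using (Prime)
open import Data.Fin using (Fin; toℕ)
open import Data.Bool using (Bool; true; false)
open import Data.List using (List; concatMap; map)
open import Data.List.Membership.Propositional using (_∈_)
open import Data.Product using (Σ; ∃; ∃-syntax; _×_; _,_; proj₁; proj₂)
open import Data.Sum using (_⊎_)
open import Relation.Binary.PropositionalEquality using (_≡_; _≢_)
open import Relation.Nullary using (¬_)

record Graph (n : ℕ) : Set where
  field
    adj     : Fin n → Fin n → Bool
    symm    : ∀ u v → adj u v ≡ adj v u
    irrefl  : ∀ u → adj u u ≡ false
open Graph public

Adj : ∀ {n} → Graph n → Fin n → Fin n → Set
Adj G u v = adj G u v ≡ true

data Reach {n} (G : Graph n) : Fin n → Fin n → Set where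
  here : ∀ {u} → Reach G u u
  step : ∀ {u w v} → Adj G u w → Reach G w v → Reach G u v

Connected : ∀ {n} → Graph n → Set
Connected G = ∀ u v → Reach G u v

Next : ∀ {k} → Fin k → Fin k → Set
Next {k} i j = (suc (toℕ i) ≡ toℕ j) ⊎ (suc (toℕ i) ≡ k × toℕ j ≡ 0)

record Cycle {n} (G : Graph n) : Set where
  field
    len      : ℕ
    len≥3    : 3 ≤ len
    vtx      : Fin len → Fin n
    distinct : ∀ i j → vtx i ≡ vtx j → i ≡ j
    closed   : ∀ i j → Next i j → Adj G (vtx i) (vtx j)
open Cycle public

EdgeOf : ∀ {n} {G : Graph n} → Cycle G → Fin n → Fin n → Set
EdgeOf c a b = ∃[ i ] ∃[ j ] (Next i j ×
  ((vtx c i ≡ a × vtx c j ≡ b) ⊎ (vtx c i ≡ b × vtx c j ≡ a)))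

-- two cycles are the same cycle (subgraph) iff they have the same edges
SameCycle : ∀ {n} {G : Graph n} → Cycle G → Cycle G → Set
SameCycle c c' = ∀ a b → (EdgeOf c a b → EdgeOf c' a b) × (EdgeOf c' a b → EdgeOf c a b)

Cactus : ∀ {n} → Graph n → Set
Cactus G = Connected G ×
  (∀ (c c' : Cycle G) → ¬ SameCycle c c' →
     ∀ i j i' j' → vtx c i ≡ vtx c' i' → vtx c j ≡ vtx c' j' → vtx c i ≡ vtx c j)

Odd : ℕ → Set
Odd k = ∃[ t ] k ≡ suc (t * 2)

OddCycleCount : ∀ {n} → Graph n → ℕ → Set
OddCycleCount G m = Σ (Fin m → Cycle G) λ c →
  (∀ i → Odd (len (c i))) ×
  (∀ i j → SameCycle (c i) (c j) → i ≡ j) ×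
  (∀ (d : Cycle G) → Odd (len d) → ∃[ i ] SameCycle d (c i))

_≃ˢ_ : List ℕ → List ℕ → Set
A ≃ˢ B = ∀ x → (x ∈ A → x ∈ B) × (x ∈ B → x ∈ A)

_⊕_ : List ℕ → List ℕ → List ℕ
A ⊕ B = concatMap (λ a → map (a +_) B) A

-- A is an AP-set (≥ 3 elements in arithmetic progression) with common
-- difference (deterministic index) d
IsAPWith : List ℕ → ℕ → Set
IsAPWith A d = 1 ≤ d × ∃[ a ] ∃[ k ] (3 ≤ k ×
  (∀ x → (x ∈ A → ∃[ i ] (i < k × x ≡ a + i * d)) ×
         (∃[ i ] (i < k × x ≡ a + i * d) → x ∈ A)))

IsAP : List ℕ → Set
IsAP A = ∃[ d ] IsAPWith A d

-- arithmetic IASI of G, together with the deterministic index of each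
-- vertex label (which is uniquely determined by the label)
record ArithIASI {n} (G : Graph n) : Set where
  field
    lab      : Fin n → List ℕ
    lab-inj  : ∀ u v → lab u ≃ˢ lab v → u ≡ v
    edge-inj : ∀ u v x y → Adj G u v → Adj G x y →
               (lab u ⊕ lab v) ≃ˢ (lab x ⊕ lab y) →
               (u ≡ x × v ≡ y) ⊎ (u ≡ y × v ≡ x)
    dind     : Fin n → ℕ
    vtx-AP   : ∀ v → IsAPWith (lab v) (dind v)
    edge-AP  : ∀ u v → Adj G u v → IsAP (lab u ⊕ lab v)
open ArithIASI public

PrimeRatio : ∀ {n} {G : Graph n} → ArithIASI G → Fin n → Fin n → Set
PrimeRatio F u v = ∃[ p ] (Prime p ×
  (dind F v ≡ p * dind F u ⊎ dind F u ≡ p * dind F v))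

-- edges are represented by ordered pairs (u , v) with u < v
IsEdge : ∀ {n} → Graph n → Fin n × Fin n → Set
IsEdge G (u , v) = toℕ u < toℕ v × Adj G u v

NonPrimeCount : ∀ {n} {G : Graph n} → ArithIASI G → ℕ → Set
NonPrimeCount {n} {G} F m = Σ (Fin m → Fin n × Fin n) λ e →
  (∀ i → IsEdge G (e i) × ¬ PrimeRatio F (proj₁ (e i)) (proj₂ (e i))) ×
  (∀ i j → e i ≡ e j → i ≡ j) ×
  (∀ uv → IsEdge G uv → ¬ PrimeRatio F (proj₁ uv) (proj₂ uv) → ∃[ i ] e i ≡ uv)

DispensingNumber : ∀ {n} → Graph n → ℕ → Set
DispensingNumber G m =
  (∃[ F ] NonPrimeCount {G = G} F m) ×
  (∀ (F : ArithIASI G) k → NonPrimeCount F k → m ≤ k)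

module Submission where

-- Let Ω x be the number of prime factors
-- of x. Along an edge with prime deterministic ratio the parity of Ω of
-- the deterministic index changes, so on an odd cycle some edge has a
-- non-prime ratio (odd-cycle-no-flip). Distinct cycles of a cactus share
-- no edge (share-edge), so these edges are distinct and m ≤ ϑ(G).
--
-- Remove one edge from each odd cycle
-- and mark the others. In a cactus every cycle then has an even number of
-- marked edges, hence so does every closed walk (closed-walks-even, by
-- cutting walks at repeated vertices). Colouring each vertex by the parity
-- of the marked edges on a path from a root gives a 2-colouring in which
-- exactly the marked edges join different colours (balanced-colouring).
-- Labelling v by {3^v, 3^v + g, 3^v + 2g}, g = 1 or 2 by colour, is an
-- arithmetic IASI (ColourIASI) in which exactly the removed edges have a
-- non-prime deterministic ratio, so ϑ(G) ≤ m.

open import Defs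
open import Data.Bool using (Bool; true; false; not; _xor_) renaming (_≟_ to _≟ᴮ_)
open import Data.Bool.Properties
  using (not-¬; not-injective; not-involutive; not-distribˡ-xor; xor-same; xor-assoc; xor-comm; xor-identityʳ; true-xor)
open import Data.Empty using (⊥; ⊥-elim)
open import Data.Fin using (Fin; toℕ; fromℕ<) renaming (zero to fzero)
open import Data.Fin.Properties
  using (toℕ-injective; toℕ<n; toℕ-fromℕ<; injective⇒≤; ¬∀⟶∃¬; any?) renaming (_≟_ to _≟ᶠ_)
open import Data.List using (List; []; _∷_; length; map)
open import Data.List.Membership.Propositional using (_∈_; find; lose)
open import Data.List.Membership.Propositional.Properties using (∈-map⁺; ∈-map⁻; ∈-concatMap⁺; ∈-concatMap⁻)
open import Data.List.Relation.Binary.Permutation.Propositional.Properties using (↭-length)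
open import Data.List.Relation.Unary.All using (_∷_)
open import Data.List.Relation.Unary.Any using (here; there)
open import Data.Nat using (ℕ; zero; suc; _+_; _*_; _∸_; _^_; _≤_; _<_; z≤n; s≤s; _≟_; _<?_)
open import Data.Nat.Induction using (<-rec)
open import Data.Nat.Primality using (Prime; prime?; ¬prime[1]; prime[2])
open import Data.Nat.Primality.Factorisation using (PrimeFactorisation; factorise; factorisationUnique; factors)
open import Data.Nat.Properties
open import Algebra.Properties.CommutativeSemigroup +-commutativeSemigroup
  using () renaming (interchange to +-interchange)
open import Data.Product using (Σ; ∃-syntax; _×_; _,_; proj₁; proj₂; swap)
open import Data.Product.Properties using (,-injective)
open import Data.Sum using (_⊎_; inj₁; inj₂)
open import Data.Unit using (tt)
open import Function using (_∘_)
open import Relation.Binary.Definitions using (tri<; tri≈; tri>)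
open import Relation.Binary.PropositionalEquality
open import Relation.Nullary using (¬_; Dec; yes; no)
open import Relation.Nullary.Decidable using (decidable-stable; toWitness; _×-dec_; _⊎-dec_)

parity : ℕ → Bool
parity zero = false
parity (suc n) = not (parity n)

parity-double : ∀ t → parity (t * 2) ≡ false
parity-double zero = refl
parity-double (suc t) = trans (not-involutive _) (parity-double t)

Odd⇒parity : ∀ {k} → Odd k → parity k ≡ true
Odd⇒parity (t , refl) = cong not (parity-double t)

half : ∀ k → ∃[ t ] (k ≡ t * 2 ⊎ k ≡ suc (t * 2))
half zero = 0 , inj₁ refl
half (suc k) with half k
... | t , inj₁ refl = t , inj₂ refl
... | t , inj₂ refl = suc t , inj₁ refl

parity⇒Odd : ∀ k → parity k ≡ true → Odd k
parity⇒Odd k odd with half k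
... | t , inj₂ refl = t , refl
... | t , inj₁ refl with trans (sym (parity-double t)) odd
... | ()

xor-middle : ∀ x y z → (x xor y) xor z ≡ y xor (x xor z)
xor-middle x y z = begin
  (x xor y) xor z  ≡⟨ cong (_xor z) (xor-comm x y) ⟩
  (y xor x) xor z  ≡⟨ xor-assoc y x z ⟩
  y xor (x xor z)  ∎
  where open ≡-Reasoning

xor-solve : ∀ x y z → x xor (y xor z) ≡ false → x xor z ≡ y
xor-solve false false false _ = refl
xor-solve false true true _ = refl
xor-solve true false true _ = refl
xor-solve true true false _ = refl
xor-solve false false true ()
xor-solve false true false ()
xor-solve true false false ()
xor-solve true true true ()

xor-false⇒≡ : ∀ {x y} → x xor y ≡ false → x ≡ y
xor-false⇒≡ {false} {false} _ = refl
xor-false⇒≡ {true} {true} _ = refl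

xor-true⇒not : ∀ {x y} → x xor y ≡ true → y ≡ not x
xor-true⇒not {false} {true} _ = refl
xor-true⇒not {true} {false} _ = refl

xorSum : (ℕ → Bool) → ℕ → Bool
xorSum f zero = false
xorSum f (suc L) = f 0 xor xorSum (λ k → f (suc k)) L

xorSum-cong : ∀ {f g} L → (∀ k → k < L → f k ≡ g k) → xorSum f L ≡ xorSum g L
xorSum-cong zero eq = refl
xorSum-cong (suc L) eq =
  cong₂ _xor_ (eq 0 (s≤s z≤n)) (xorSum-cong L (λ k k<L → eq (suc k) (s≤s k<L)))

xorSum-+ : ∀ f a b → xorSum f (a + b) ≡ xorSum f a xor xorSum (λ k → f (a + k)) b
xorSum-+ f zero b = refl
xorSum-+ f (suc a) b =
  trans (cong (f 0 xor_) (xorSum-+ (λ k → f (suc k)) a b)) (sym (xor-assoc (f 0) _ _))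

xorSum-true : ∀ {f} L → (∀ k → k < L → f k ≡ true) → xorSum f L ≡ parity L
xorSum-true zero all = refl
xorSum-true (suc L) all =
  trans (cong₂ _xor_ (all 0 (s≤s z≤n)) (xorSum-true L (λ k k<L → all (suc k) (s≤s k<L))))
        (true-xor _)

xorSum-oneFalse : ∀ {f} L k₀ → k₀ < L → f k₀ ≡ false →
  (∀ k → k < L → k ≢ k₀ → f k ≡ true) → xorSum f L ≡ not (parity L)
xorSum-oneFalse {f} (suc L) zero _ f0 others =
  trans (cong₂ _xor_ f0 (xorSum-true L (λ k k<L → others (suc k) (s≤s k<L) λ ())))
        (sym (not-involutive _))
xorSum-oneFalse {f} (suc L) (suc k₀) (s≤s k₀<L) fk₀ others =
  trans (cong₂ _xor_ (others 0 (s≤s z≤n) λ ())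
          (xorSum-oneFalse L k₀ k₀<L fk₀ (λ k k<L k≢k₀ → others (suc k) (s≤s k<L) (k≢k₀ ∘ suc-injective))))
        (true-xor _)

SamePair : ∀ {A : Set} → A → A → A → A → Set
SamePair a b x y = (a ≡ x × b ≡ y) ⊎ (a ≡ y × b ≡ x)

SamePair-sym : ∀ {A : Set} {a b x y : A} → SamePair a b x y → SamePair x y a b
SamePair-sym (inj₁ (p , q)) = inj₁ (sym p , sym q)
SamePair-sym (inj₂ (p , q)) = inj₂ (sym q , sym p)

SamePair-trans : ∀ {A : Set} {a b x y u v : A} →
  SamePair a b x y → SamePair x y u v → SamePair a b u v
SamePair-trans (inj₁ (p , q)) (inj₁ (r , s)) = inj₁ (trans p r , trans q s)
SamePair-trans (inj₁ (p , q)) (inj₂ (r , s)) = inj₂ (trans p r , trans q s)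
SamePair-trans (inj₂ (p , q)) (inj₁ (r , s)) = inj₂ (trans p s , trans q r)
SamePair-trans (inj₂ (p , q)) (inj₂ (r , s)) = inj₁ (trans p s , trans q r)

SamePair-swap : ∀ {A : Set} {a b x y : A} → SamePair a b x y → SamePair b a x y
SamePair-swap (inj₁ (p , q)) = inj₂ (q , p)
SamePair-swap (inj₂ (p , q)) = inj₁ (q , p)

next : ∀ {k} → Fin k → Fin k
next {suc k} i with suc (toℕ i) <? suc k
... | yes lt = fromℕ< lt
... | no _ = fzero

Next-next : ∀ {k} (i : Fin k) → Next i (next i)
Next-next {suc k} i with suc (toℕ i) <? suc k
... | yes lt = inj₁ (sym (toℕ-fromℕ< lt))
... | no ¬lt with m<1+n⇒m<n∨m≡n (s≤s (toℕ<n i))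
...   | inj₁ lt = ⊥-elim (¬lt lt)
...   | inj₂ eq = inj₂ (eq , refl)

Next-functional : ∀ {k} {i j j′ : Fin k} → Next i j → Next i j′ → j ≡ j′
Next-functional (inj₁ p) (inj₁ q) = toℕ-injective (trans (sym p) q)
Next-functional {j = j} (inj₁ p) (inj₂ (q , _)) = ⊥-elim (<-irrefl (trans (sym p) q) (toℕ<n j))
Next-functional {j′ = j′} (inj₂ (q , _)) (inj₁ p) = ⊥-elim (<-irrefl (trans (sym p) q) (toℕ<n j′))
Next-functional (inj₂ (_ , p)) (inj₂ (_ , q)) = toℕ-injective (trans p (sym q))

Next-asym : ∀ {k} {i j : Fin k} → 3 ≤ k → Next i j → Next j i → ⊥
Next-asym {k} {i} {j} k≥3 = asym (toℕ i) (toℕ j) k≥3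
  where
  ss≢ : ∀ a → suc (suc a) ≢ a
  ss≢ zero ()
  ss≢ (suc a) e = ss≢ a (suc-injective e)
  asym : ∀ a b → 3 ≤ k → (suc a ≡ b ⊎ (suc a ≡ k × b ≡ 0)) →
                         (suc b ≡ a ⊎ (suc b ≡ k × a ≡ 0)) → ⊥
  asym a .(suc a) _ (inj₁ refl) (inj₁ q) = ss≢ a q
  asym .0 .1 (s≤s (s≤s ())) (inj₁ refl) (inj₂ (refl , refl))
  asym .1 .0 (s≤s (s≤s ())) (inj₂ (refl , refl)) (inj₁ refl)

odd-cycle-no-flip : ∀ k (h : Fin k → Bool) → (∀ p → h (next p) ≡ not (h p)) → Odd k → ⊥
odd-cycle-no-flip zero h flip (t , ())
odd-cycle-no-flip (suc k) h flip odd =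
  not-¬ refl (trans (cong h (sym next-last))
    (trans (flip last) (cong not (trans (at k ≤-refl) (cong (_xor h fzero) parity-k)))))
  where
  at : ∀ j (j<1+k : j < suc k) → h (fromℕ< j<1+k) ≡ parity j xor h fzero
  at zero _ = refl
  at (suc j) j<1+k = begin
    h (fromℕ< j<1+k)            ≡⟨ cong h (Next-functional (Next-next p) p↦j) ⟨
    h (next p)                  ≡⟨ flip p ⟩
    not (h p)                   ≡⟨ cong not (at j j<k) ⟩
    not (parity j xor h fzero)  ≡⟨ not-distribˡ-xor (parity j) (h fzero) ⟩
    parity (suc j) xor h fzero  ∎
    where
    open ≡-Reasoning
    j<k = ≤-trans (n≤1+n _) j<1+k
    p = fromℕ< j<k
    p↦j : Next p (fromℕ< j<1+k)
    p↦j = inj₁ (trans (cong suc (toℕ-fromℕ< j<k)) (sym (toℕ-fromℕ< j<1+k)))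
  last : Fin (suc k)
  last = fromℕ< {k} ≤-refl
  next-last : next last ≡ fzero
  next-last = Next-functional (Next-next last) (inj₂ (cong suc (toℕ-fromℕ< {k} ≤-refl) , refl))
  parity-k : parity k ≡ false
  parity-k = not-injective (Odd⇒parity odd)

module CycleFacts {n : ℕ} (G : Graph n) where

  adj⇒≢ : ∀ {a b} → Adj G a b → a ≢ b
  adj⇒≢ {a} ab refl with trans (sym ab) (irrefl G a)
  ... | ()

  adj-sym : ∀ {a b} → Adj G a b → Adj G b a
  adj-sym {a} {b} ab = trans (symm G b a) ab

  edgeAt : (c : Cycle G) (p : Fin (len c)) → EdgeOf c (vtx c p) (vtx c (next p))
  edgeAt c p = p , next p , Next-next p , inj₁ (refl , refl)

  EdgeOf-SamePair : (c : Cycle G) → ∀ {a b x y} → SamePair a b x y → EdgeOf c a b → EdgeOf c x y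
  EdgeOf-SamePair c ab≐xy (i , j , i↦j , e) = i , j , i↦j , SamePair-trans e ab≐xy

  edge-position : (c : Cycle G) {p q p′ q′ : Fin (len c)} → Next p q → Next p′ q′ →
    SamePair (vtx c p) (vtx c q) (vtx c p′) (vtx c q′) → p ≡ p′
  edge-position c _ _ (inj₁ (e , _)) = distinct c _ _ e
  edge-position c p↦q p′↦q′ (inj₂ (e₁ , e₂)) with distinct c _ _ e₁ | distinct c _ _ e₂
  ... | refl | refl = ⊥-elim (Next-asym (len≥3 c) p↦q p′↦q′)

  -- the same cycle traversed twice has the same length: positions of c
  -- inject into positions of c′ through the edges leaving them
  SameCycle-len≤ : (c c′ : Cycle G) → SameCycle c c′ → len c ≤ len c′
  SameCycle-len≤ c c′ same = injective⇒≤ {f = position} injective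
    where
    edge′ : (p : Fin (len c)) → EdgeOf c′ (vtx c p) (vtx c (next p))
    edge′ p = proj₁ (same (vtx c p) (vtx c (next p))) (edgeAt c p)
    position : Fin (len c) → Fin (len c′)
    position p = proj₁ (edge′ p)
    injective : ∀ {p p′} → position p ≡ position p′ → p ≡ p′
    injective {p} {p′} eq with edge′ p | edge′ p′
    ... | (i , j , i↦j , e) | (i′ , j′ , i′↦j′ , e′) with eq
    ... | refl with Next-functional i↦j i′↦j′
    ... | refl = edge-position c (Next-next p) (Next-next p′) (SamePair-trans (SamePair-sym e) e′)

  SameCycle-len : (c c′ : Cycle G) → SameCycle c c′ → len c ≡ len c′
  SameCycle-len c c′ same = ≤-antisym (SameCycle-len≤ c c′ same)
    (SameCycle-len≤ c′ c (λ a b → proj₂ (same a b) , proj₁ (same a b)))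

  endpoints : (c : Cycle G) → ∀ {a b} → EdgeOf c a b →
    (∃[ i ] vtx c i ≡ a) × (∃[ j ] vtx c j ≡ b)
  endpoints c (i , j , _ , inj₁ (p , q)) = (i , p) , (j , q)
  endpoints c (i , j , _ , inj₂ (p , q)) = (j , q) , (i , p)

  -- In a cactus two cycles sharing an edge are the same cycle (stated
  -- doubly negated, as SameCycle is not decidable in general).
  share-edge : Cactus G → (c c′ : Cycle G) → ∀ {a b} → Adj G a b →
    EdgeOf c a b → EdgeOf c′ a b → ¬ ¬ SameCycle c c′
  share-edge (_ , meet≤1) c c′ ab e e′ different with endpoints c e | endpoints c′ e′
  ... | (i , ca) , (j , cb) | (i′ , c′a) , (j′ , c′b) =
    adj⇒≢ ab (trans (sym ca) (trans (meet≤1 c c′ different i j i′ j′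
      (trans ca (sym c′a)) (trans cb (sym c′b))) cb))

-- The representative (u , v) with u < v of an unordered pair {a , b};
-- NonPrimeCount lists edges in this form.
orient : ∀ {n} → Fin n → Fin n → Fin n × Fin n
orient a b with <-cmp (toℕ a) (toℕ b)
... | tri< _ _ _ = a , b
... | tri≈ _ _ _ = a , b
... | tri> _ _ _ = b , a

orient-cases : ∀ {n} (a b : Fin n) → orient a b ≡ (a , b) ⊎ orient a b ≡ (b , a)
orient-cases a b with <-cmp (toℕ a) (toℕ b)
... | tri< _ _ _ = inj₁ refl
... | tri≈ _ _ _ = inj₁ refl
... | tri> _ _ _ = inj₂ refl

orient-injective : ∀ {n} {a b x y : Fin n} → orient a b ≡ orient x y → SamePair a b x y
orient-injective {a = a} {b} {x} {y} eq with orient-cases a b | orient-cases x y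
... | inj₁ p | inj₁ q = inj₁ (,-injective (trans (sym p) (trans eq q)))
... | inj₁ p | inj₂ q = inj₂ (,-injective (trans (sym p) (trans eq q)))
... | inj₂ p | inj₁ q = inj₂ (swap (,-injective (trans (sym p) (trans eq q))))
... | inj₂ p | inj₂ q = inj₁ (swap (,-injective (trans (sym p) (trans eq q))))

orient-IsEdge : ∀ {n} (G : Graph n) {a b} → Adj G a b → IsEdge G (orient a b)
orient-IsEdge G {a} {b} ab with <-cmp (toℕ a) (toℕ b)
... | tri< lt _ _ = lt , ab
... | tri≈ _ eq _ = ⊥-elim (CycleFacts.adj⇒≢ G ab (toℕ-injective eq))
... | tri> _ _ gt = gt , CycleFacts.adj-sym G ab

orient-ordered : ∀ {n} {a b u v : Fin n} → toℕ u < toℕ v → SamePair a b u v → orient a b ≡ (u , v)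
orient-ordered {u = u} {v} lt (inj₁ (refl , refl)) with <-cmp (toℕ u) (toℕ v)
... | tri< _ _ _ = refl
... | tri≈ ¬lt _ _ = ⊥-elim (¬lt lt)
... | tri> _ _ gt = ⊥-elim (<-asym lt gt)
orient-ordered {u = u} {v} lt (inj₂ (refl , refl)) with <-cmp (toℕ v) (toℕ u)
... | tri< gt _ _ = ⊥-elim (<-asym lt gt)
... | tri≈ _ eq _ = ⊥-elim (<-irrefl (sym eq) lt)
... | tri> _ _ _ = refl

PrimeRatio-sym : ∀ {n} {G : Graph n} (F : ArithIASI G) {u v} → PrimeRatio F u v → PrimeRatio F v u
PrimeRatio-sym F (p , p-isPrime , inj₁ e) = p , p-isPrime , inj₂ e
PrimeRatio-sym F (p , p-isPrime , inj₂ e) = p , p-isPrime , inj₁ e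

orient-¬PrimeRatio : ∀ {n} {G : Graph n} (F : ArithIASI G) {a b} → ¬ PrimeRatio F a b →
  ¬ PrimeRatio F (proj₁ (orient a b)) (proj₂ (orient a b))
orient-¬PrimeRatio F {a} {b} ¬pr with orient a b | orient-cases a b
... | _ | inj₁ refl = ¬pr
... | _ | inj₂ refl = ¬pr ∘ PrimeRatio-sym F

Ω : ℕ → ℕ
Ω zero = 0
Ω (suc x) = length (factors (factorise (suc x)))

-- Multiplying by a prime adds one prime factor (uniqueness of factorisation).
Ω-prime* : ∀ p x → Prime p → Ω (p * suc x) ≡ suc (Ω (suc x))
Ω-prime* 1 x p-isPrime = ⊥-elim (¬prime[1] p-isPrime)
Ω-prime* (suc (suc p)) x p-isPrime =
  ↭-length (factorisationUnique (factorise (suc (suc p) * suc x)) p*x)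
  where
  fx = factorise (suc x)
  p*x : PrimeFactorisation (suc (suc p) * suc x)
  p*x = record
    { factors = suc (suc p) ∷ factors fx
    ; isFactorisation = cong (suc (suc p) *_) (PrimeFactorisation.isFactorisation fx)
    ; factorsPrime = p-isPrime ∷ PrimeFactorisation.factorsPrime fx }

PrimeRatioℕ : ℕ → ℕ → Set
PrimeRatioℕ a b = ∃[ p ] (Prime p × (b ≡ p * a ⊎ a ≡ p * b))

-- decidable, since such a prime is at most a + b
PrimeRatioℕ? : ∀ a b → 1 ≤ a → 1 ≤ b → Dec (PrimeRatioℕ a b)
PrimeRatioℕ? a b a≥1 b≥1
  with anyUpTo? (λ p → prime? p ×-dec ((b ≟ p * a) ⊎-dec (a ≟ p * b))) (suc (a + b))
... | yes (p , _ , r) = yes (p , r)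
... | no none = no λ (p , r) → none (p , s≤s (bound p (proj₂ r)) , r)
  where
  factor≤ : ∀ p x y → 1 ≤ x → y ≡ p * x → p ≤ y
  factor≤ p (suc x) y _ refl = m≤m*n p (suc x)
  bound : ∀ p → (b ≡ p * a ⊎ a ≡ p * b) → p ≤ a + b
  bound p (inj₁ e) = ≤-trans (factor≤ p a b a≥1 e) (m≤n+m b a)
  bound p (inj₂ e) = ≤-trans (factor≤ p b a b≥1 e) (m≤m+n a b)

PrimeRatioℕ-flips : ∀ {a b} → 1 ≤ a → 1 ≤ b → PrimeRatioℕ a b →
  parity (Ω b) ≡ not (parity (Ω a))
PrimeRatioℕ-flips {suc a} {suc b} _ _ (p , p-isPrime , inj₁ e) =
  cong parity (trans (cong Ω e) (Ω-prime* p a p-isPrime))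
PrimeRatioℕ-flips {suc a} {suc b} _ _ (p , p-isPrime , inj₂ e) =
  sym (trans (cong (not ∘ parity) (trans (cong Ω e) (Ω-prime* p b p-isPrime))) (not-involutive _))

module LowerBound {n : ℕ} (G : Graph n) (cactus : Cactus G) where
  open CycleFacts G

  -- deterministic indices are positive, so prime ratios are decidable
  dind-pos : (F : ArithIASI G) → ∀ v → 1 ≤ dind F v
  dind-pos F v = proj₁ (vtx-AP F v)

  PrimeRatio? : (F : ArithIASI G) → ∀ u v → Dec (PrimeRatio F u v)
  PrimeRatio? F u v = PrimeRatioℕ? (dind F u) (dind F v) (dind-pos F u) (dind-pos F v)

  -- If every edge of an odd cycle had a prime ratio, the parity of Ω of
  -- the deterministic index would 2-colour the cycle.
  odd-cycle-dispensed : (F : ArithIASI G) (c : Cycle G) → Odd (len c) →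
    ∃[ p ] ¬ PrimeRatio F (vtx c p) (vtx c (next p))
  odd-cycle-dispensed F c odd =
    ¬∀⟶∃¬ (len c) (λ p → PrimeRatio F (vtx c p) (vtx c (next p))) (λ p → PrimeRatio? F _ _)
      λ allPrime → odd-cycle-no-flip (len c) (λ p → parity (Ω (dind F (vtx c p))))
        (λ p → PrimeRatioℕ-flips (dind-pos F _) (dind-pos F _) (allPrime p)) odd

  -- Sending each odd cycle to (the index in the list of non-prime edges
  -- of) one of its dispensed edges is injective, since cycles share no edge.
  lower-bound : ∀ m → OddCycleCount G m → ∀ (F : ArithIASI G) k → NonPrimeCount F k → m ≤ k
  lower-bound m (c , c-odd , c-distinct , _) F k (e , _ , _ , e-complete) =
    injective⇒≤ {f = index} index-injective
    where
    pos : (i : Fin m) → Fin (len (c i))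
    pos i = proj₁ (odd-cycle-dispensed F (c i) (c-odd i))
    a b : Fin m → Fin n
    a i = vtx (c i) (pos i)
    b i = vtx (c i) (next (pos i))
    ab : ∀ i → Adj G (a i) (b i)
    ab i = closed (c i) _ _ (Next-next (pos i))
    listed : ∀ i → ∃[ j ] e j ≡ orient (a i) (b i)
    listed i = e-complete (orient (a i) (b i)) (orient-IsEdge G (ab i))
      (orient-¬PrimeRatio F (proj₂ (odd-cycle-dispensed F (c i) (c-odd i))))
    index : Fin m → Fin k
    index i = proj₁ (listed i)
    index-injective : ∀ {i i′} → index i ≡ index i′ → i ≡ i′
    index-injective {i} {i′} eq = decidable-stable (i ≟ᶠ i′) λ i≢i′ →
      share-edge cactus (c i) (c i′) (ab i) (edgeAt (c i) (pos i))
        (EdgeOf-SamePair (c i′) (SamePair-sym same) (edgeAt (c i′) (pos i′)))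
        (i≢i′ ∘ c-distinct i i′)
      where
      same : SamePair (a i) (b i) (a i′) (b i′)
      same = orient-injective (trans (sym (proj₂ (listed i))) (trans (cong e eq) (proj₂ (listed i′))))

ap : ℕ → ℕ → ℕ → List ℕ
ap a d zero = []
ap a d (suc k) = a ∷ ap (a + d) d k

ap-∈⁻ : ∀ {x} a d k → x ∈ ap a d k → ∃[ i ] (i < k × x ≡ a + i * d)
ap-∈⁻ a d (suc k) (here e) = 0 , s≤s z≤n , trans e (sym (+-identityʳ a))
ap-∈⁻ a d (suc k) (there x∈) with ap-∈⁻ (a + d) d k x∈
... | i , i<k , e = suc i , s≤s i<k , trans e (+-assoc a d (i * d))

ap-∈⁺ : ∀ {x} a d k i → i < k → x ≡ a + i * d → x ∈ ap a d k
ap-∈⁺ a d (suc k) zero _ e = here (trans e (+-identityʳ a))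
ap-∈⁺ a d (suc k) (suc i) (s≤s i<k) e =
  there (ap-∈⁺ (a + d) d k i i<k (trans e (sym (+-assoc a d (i * d)))))

ap-IsAPWith : ∀ a d k → 1 ≤ d → 3 ≤ k → IsAPWith (ap a d k) d
ap-IsAPWith a d k d≥1 k≥3 =
  d≥1 , a , k , k≥3 , λ x → ap-∈⁻ a d k , λ (i , i<k , e) → ap-∈⁺ a d k i i<k e

ap-min : ∀ {x} a d k → x ∈ ap a d k → a ≤ x
ap-min a d k x∈ with ap-∈⁻ a d k x∈
... | i , _ , refl = m≤m+n a (i * d)

⊕-∈⁻ : ∀ {x} A B → x ∈ A ⊕ B → ∃[ y ] ∃[ z ] (y ∈ A × z ∈ B × x ≡ y + z)
⊕-∈⁻ A B x∈ with find (∈-concatMap⁻ (λ a → map (a +_) B) {xs = A} x∈)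
... | y , y∈A , x∈y+B with ∈-map⁻ (y +_) x∈y+B
... | z , z∈B , e = y , z , y∈A , z∈B , e

⊕-∈⁺ : ∀ {y z} A B → y ∈ A → z ∈ B → y + z ∈ A ⊕ B
⊕-∈⁺ {y} A B y∈A z∈B = ∈-concatMap⁺ (λ a → map (a +_) B) {xs = A} (lose y∈A (∈-map⁺ (y +_) z∈B))

ap⊕ap-min : ∀ {x} a b d e k l → x ∈ ap a d k ⊕ ap b e l → a + b ≤ x
ap⊕ap-min a b d e k l x∈ with ⊕-∈⁻ (ap a d k) (ap b e l) x∈
... | y , z , y∈ , z∈ , refl = +-mono-≤ (ap-min a d k y∈) (ap-min b e l z∈)

ap⊕ap-∋ : ∀ a b d e k l → a + b ∈ ap a d (suc k) ⊕ ap b e (suc l)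
ap⊕ap-∋ a b d e k l = ⊕-∈⁺ (ap a d (suc k)) (ap b e (suc l)) (here refl) (here refl)

-- Vertex labels are 3-term progressions with common difference gap x;
-- the two gaps 1 and 2 have ratio 2.
gap : Bool → ℕ
gap true = 1
gap false = 2

gap≥1 : ∀ x → 1 ≤ gap x
gap≥1 true = s≤s z≤n
gap≥1 false = s≤s z≤n

-- {i d + j e : i, j < 3} = {t c : t < K}, a finite fact checked by
-- evaluation for the gaps in use.
Spans : ℕ → ℕ → ℕ → ℕ → Set
Spans d e c K = (∀ {i} → i < 3 → ∀ {j} → j < 3 → ∃[ t ] (t < K × i * d + j * e ≡ t * c)) ×
                (∀ {t} → t < K → ∃[ i ] (i < 3 × ∃[ j ] (j < 3 × i * d + j * e ≡ t * c)))

Spans? : ∀ d e c K → Dec (Spans d e c K)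
Spans? d e c K =
  allUpTo? (λ i → allUpTo? (λ j → anyUpTo? (λ t → i * d + j * e ≟ t * c) K) 3) 3 ×-dec
  allUpTo? (λ t → anyUpTo? (λ i → anyUpTo? (λ j → i * d + j * e ≟ t * c) 3) 3) K

sumGap sumSize : Bool → Bool → ℕ
sumGap false false = 2
sumGap _ _ = 1
sumSize true true = 5
sumSize false false = 5
sumSize _ _ = 7

gaps-span : ∀ x y → Spans (gap x) (gap y) (sumGap x y) (sumSize x y)
gaps-span true true = toWitness {a? = Spans? 1 1 1 5} tt
gaps-span true false = toWitness {a? = Spans? 1 2 1 7} tt
gaps-span false true = toWitness {a? = Spans? 2 1 1 7} tt
gaps-span false false = toWitness {a? = Spans? 2 2 2 5} tt

sumGap≥1 : ∀ x y → 1 ≤ sumGap x y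
sumGap≥1 true y = s≤s z≤n
sumGap≥1 false true = s≤s z≤n
sumGap≥1 false false = s≤s z≤n

sumSize≥3 : ∀ x y → 3 ≤ sumSize x y
sumSize≥3 true true = s≤s (s≤s (s≤s z≤n))
sumSize≥3 true false = s≤s (s≤s (s≤s z≤n))
sumSize≥3 false true = s≤s (s≤s (s≤s z≤n))
sumSize≥3 false false = s≤s (s≤s (s≤s z≤n))

label-sum-AP : ∀ a b x y → IsAPWith (ap a (gap x) 3 ⊕ ap b (gap y) 3) (sumGap x y)
label-sum-AP a b x y =
  sumGap≥1 x y , a + b , sumSize x y , sumSize≥3 x y , λ v → into v , onto v
  where
  A = ap a (gap x) 3
  B = ap b (gap y) 3
  into : ∀ v → v ∈ A ⊕ B → ∃[ t ] (t < sumSize x y × v ≡ (a + b) + t * sumGap x y)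
  into v v∈ with ⊕-∈⁻ A B v∈
  ... | _ , _ , p∈ , q∈ , refl with ap-∈⁻ a (gap x) 3 p∈ | ap-∈⁻ b (gap y) 3 q∈
  ... | i , i<3 , refl | j , j<3 , refl with proj₁ (gaps-span x y) i<3 j<3
  ... | t , t<K , e = t , t<K , trans (+-interchange a _ b _) (cong ((a + b) +_) e)
  onto : ∀ v → ∃[ t ] (t < sumSize x y × v ≡ (a + b) + t * sumGap x y) → v ∈ A ⊕ B
  onto v (t , t<K , refl) with proj₂ (gaps-span x y) t<K
  ... | i , i<3 , j , j<3 , e =
    subst (_∈ A ⊕ B) (trans (+-interchange a _ b _) (cong ((a + b) +_) e))
      (⊕-∈⁺ A B (ap-∈⁺ a (gap x) 3 i i<3 refl) (ap-∈⁺ b (gap y) 3 j j<3 refl))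

-- Powers of three form a Sidon set: 3^u + 3^v determines {u , v}.
3^-< : ∀ {u v} → u < v → 3 ^ u < 3 ^ v
3^-< = ^-monoʳ-< 3 (s≤s (s≤s z≤n))

3^-injective : ∀ {u v} → 3 ^ u ≡ 3 ^ v → u ≡ v
3^-injective {u} {v} e with <-cmp u v
... | tri< lt _ _ = ⊥-elim (<-irrefl e (3^-< lt))
... | tri≈ _ eq _ = eq
... | tri> _ _ gt = ⊥-elim (<-irrefl (sym e) (3^-< gt))

-- 3^u + 3^v < 2 · 3^v ≤ 3^y for u < v < y
3^+3^-< : ∀ {u v y} → u < v → v < y → 3 ^ u + 3 ^ v < 3 ^ y
3^+3^-< {u} {v} {y} u<v v<y = <-≤-trans (+-monoˡ-< (3 ^ v) (3^-< u<v))
  (≤-trans (+-monoʳ-≤ (3 ^ v) (m≤m+n (3 ^ v) (3 ^ v + 0))) (^-monoʳ-≤ 3 v<y))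

3^-sidon-< : ∀ {u v x y} → u < v → x < y → 3 ^ u + 3 ^ v ≡ 3 ^ x + 3 ^ y → u ≡ x × v ≡ y
3^-sidon-< {u} {v} {x} {y} u<v x<y e with <-cmp v y
... | tri< v<y _ _ = ⊥-elim (<-irrefl e (<-≤-trans (3^+3^-< u<v v<y) (m≤n+m (3 ^ y) (3 ^ x))))
... | tri> _ _ y<v = ⊥-elim (<-irrefl (sym e) (<-≤-trans (3^+3^-< x<y y<v) (m≤n+m (3 ^ v) (3 ^ u))))
... | tri≈ _ refl _ = 3^-injective (+-cancelʳ-≡ (3 ^ v) (3 ^ u) (3 ^ x) e) , refl

3^-sidon : ∀ {u v x y} → u ≢ v → x ≢ y → 3 ^ u + 3 ^ v ≡ 3 ^ x + 3 ^ y → SamePair u v x y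
3^-sidon {u} {v} {x} {y} u≢v x≢y e with <-cmp u v | <-cmp x y
... | tri≈ _ u≡v _ | _ = ⊥-elim (u≢v u≡v)
... | _ | tri≈ _ x≡y _ = ⊥-elim (x≢y x≡y)
... | tri< u<v _ _ | tri< x<y _ _ = inj₁ (3^-sidon-< u<v x<y e)
... | tri< u<v _ _ | tri> _ _ y<x = inj₂ (3^-sidon-< u<v y<x (trans e (+-comm (3 ^ x) (3 ^ y))))
... | tri> _ _ v<u | tri< x<y _ _ =
  let (v≡x , u≡y) = 3^-sidon-< v<u x<y (trans (+-comm (3 ^ v) (3 ^ u)) e) in inj₂ (u≡y , v≡x)
... | tri> _ _ v<u | tri> _ _ y<x =
  let (v≡y , u≡x) = 3^-sidon-< v<u y<x (trans (+-comm (3 ^ v) (3 ^ u)) (trans e (+-comm (3 ^ x) (3 ^ y))))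
  in inj₁ (u≡x , v≡y)

-- Least elements 3^v make labels and edge sums injective, and an edge has
-- a prime deterministic ratio (namely 2) exactly when its colours differ.
module ColourIASI {n : ℕ} (G : Graph n) (col : Fin n → Bool) where

  label : Fin n → List ℕ
  label v = ap (3 ^ toℕ v) (gap (col v)) 3

  label-least : ∀ u v → label u ≃ˢ label v → 3 ^ toℕ v ≤ 3 ^ toℕ u
  label-least u v eq = ap-min (3 ^ toℕ v) (gap (col v)) 3 (proj₁ (eq _) (here refl))

  label-injective : ∀ u v → label u ≃ˢ label v → u ≡ v
  label-injective u v eq = toℕ-injective (3^-injective (≤-antisym
    (label-least v u (λ x → proj₂ (eq x) , proj₁ (eq x))) (label-least u v eq)))

  sum-least : ∀ u v x y → (label u ⊕ label v) ≃ˢ (label x ⊕ label y) →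
    3 ^ toℕ x + 3 ^ toℕ y ≤ 3 ^ toℕ u + 3 ^ toℕ v
  sum-least u v x y eq = ap⊕ap-min (3 ^ toℕ x) (3 ^ toℕ y) _ _ 3 3
    (proj₁ (eq _) (ap⊕ap-∋ (3 ^ toℕ u) (3 ^ toℕ v) _ _ 2 2))

  adj⇒toℕ-≢ : ∀ {a b} → Adj G a b → toℕ a ≢ toℕ b
  adj⇒toℕ-≢ ab = CycleFacts.adj⇒≢ G ab ∘ toℕ-injective

  edge-injective : ∀ u v x y → Adj G u v → Adj G x y →
    (label u ⊕ label v) ≃ˢ (label x ⊕ label y) → (u ≡ x × v ≡ y) ⊎ (u ≡ y × v ≡ x)
  edge-injective u v x y uv xy eq with 3^-sidon (adj⇒toℕ-≢ uv) (adj⇒toℕ-≢ xy)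
    (≤-antisym (sum-least x y u v (λ z → proj₂ (eq z) , proj₁ (eq z))) (sum-least u v x y eq))
  ... | inj₁ (p , q) = inj₁ (toℕ-injective p , toℕ-injective q)
  ... | inj₂ (p , q) = inj₂ (toℕ-injective p , toℕ-injective q)

  F : ArithIASI G
  F = record
    { lab = label
    ; lab-inj = label-injective
    ; edge-inj = edge-injective
    ; dind = gap ∘ col
    ; vtx-AP = λ v → ap-IsAPWith (3 ^ toℕ v) (gap (col v)) 3 (gap≥1 (col v)) ≤-refl
    ; edge-AP = λ u v _ → sumGap (col u) (col v) , label-sum-AP (3 ^ toℕ u) (3 ^ toℕ v) (col u) (col v) }

  differ⇒PrimeRatio : ∀ {u v} → col v ≡ not (col u) → PrimeRatio F u v
  differ⇒PrimeRatio {u} {v} eq rewrite eq with col u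
  ... | true = 2 , prime[2] , inj₁ refl
  ... | false = 2 , prime[2] , inj₂ refl

  same⇒¬PrimeRatio : ∀ {u v} → col u ≡ col v → ¬ PrimeRatio F u v
  same⇒¬PrimeRatio {u} {v} eq (p , p-isPrime , ratio) rewrite eq =
    ¬prime[1] (subst Prime (ratio-one (gap (col v)) (gap≥1 (col v)) ratio) p-isPrime)
    where
    ratio-one : ∀ g → 1 ≤ g → g ≡ p * g ⊎ g ≡ p * g → p ≡ 1
    ratio-one (suc g) _ (inj₁ e) = sym (*-cancelʳ-≡ 1 p (suc g) (trans (*-identityˡ (suc g)) e))
    ratio-one (suc g) _ (inj₂ e) = sym (*-cancelʳ-≡ 1 p (suc g) (trans (*-identityˡ (suc g)) e))

module Walks {n : ℕ} (G : Graph n) where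

  ClosedWalk : ℕ → (ℕ → Fin n) → Set
  ClosedWalk L w = (∀ k → k < L → Adj G (w k) (w (suc k))) × (w 0 ≡ w L)

  Simple : ℕ → (ℕ → Fin n) → Set
  Simple L w = ∀ a b → a < L → b < L → w a ≡ w b → a ≡ b

  repeat-or-simple : ∀ L w → (∃[ a ] ∃[ b ] (a < b × b < L × w a ≡ w b)) ⊎ Simple L w
  repeat-or-simple L w with anyUpTo? (λ b → anyUpTo? (λ a → w a ≟ᶠ w b) b) L
  ... | yes (b , b<L , a , a<b , e) = inj₁ (a , b , a<b , b<L , e)
  ... | no no-repeat = inj₂ simple
    where
    simple : Simple L w
    simple a b a<L b<L e with <-cmp a b
    ... | tri< a<b _ _ = ⊥-elim (no-repeat (b , b<L , a , a<b , e))
    ... | tri≈ _ a≡b _ = a≡b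
    ... | tri> _ _ b<a = ⊥-elim (no-repeat (a , a<L , b , b<a , sym e))

  module AsCycle (L : ℕ) (w : ℕ → Fin n) (L≥3 : 3 ≤ L) (walk : ClosedWalk L w) (simple : Simple L w) where

    after : ∀ {i j : Fin L} → Next i j → w (toℕ j) ≡ w (suc (toℕ i))
    after (inj₁ e) = cong w (sym e)
    after (inj₂ (e , j≡0)) = trans (cong w j≡0) (trans (proj₂ walk) (cong w (sym e)))

    cycle : Cycle G
    cycle = record
      { len = L ; len≥3 = L≥3 ; vtx = λ i → w (toℕ i)
      ; distinct = λ i j e → toℕ-injective (simple _ _ (toℕ<n i) (toℕ<n j) e)
      ; closed = λ i j i↦j → subst (Adj G (w (toℕ i))) (sym (after i↦j)) (proj₁ walk (toℕ i) (toℕ<n i)) }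

    edge-at : ∀ {k} (k<L : k < L) → SamePair (vtx cycle (fromℕ< k<L)) (vtx cycle (next (fromℕ< k<L))) (w k) (w (suc k))
    edge-at {k} k<L = inj₁ (cong w (toℕ-fromℕ< k<L) ,
      trans (after (Next-next (fromℕ< k<L))) (cong (w ∘ suc) (toℕ-fromℕ< k<L)))

    step-edge : ∀ {k} → k < L → ∀ {a b} → SamePair (w k) (w (suc k)) a b → EdgeOf cycle a b
    step-edge k<L same = fromℕ< k<L , next (fromℕ< k<L) , Next-next _ , SamePair-trans (edge-at k<L) same

module WalkParity {n : ℕ} (G : Graph n) (μ : Fin n → Fin n → Bool)
                  (μ-sym : ∀ a b → μ a b ≡ μ b a) where
  open CycleFacts G
  open Walks G

  parityOf : (ℕ → Fin n) → ℕ → Bool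
  parityOf w L = xorSum (λ k → μ (w k) (w (suc k))) L

  -- Cutting the closed walk w of length (a + m) + s at a repeated vertex
  -- w a = w (a + m) gives an inner closed walk of length m and an outer
  -- one of length a + s; their parities add up to that of w.
  module Cut (a m s : ℕ) (w : ℕ → Fin n) (walk : ClosedWalk ((a + m) + s) w)
             (repeat : w a ≡ w (a + m)) where
    b = a + m

    inner : ℕ → Fin n
    inner k = w (a + k)

    -- follow w up to a, then jump to b and continue to the end
    outer : ℕ → Fin n
    outer k = skip (k ∸ a) k
      where
      skip : ℕ → ℕ → Fin n
      skip zero k = w k
      skip (suc j) _ = w (b + suc j)

    outer-early : ∀ k → k ≤ a → outer k ≡ w k
    outer-early k k≤a rewrite m≤n⇒m∸n≡0 k≤a = refl

    outer-late : ∀ j → outer (a + j) ≡ w (b + j)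
    outer-late zero rewrite m+n∸m≡n a 0 = trans (cong w (+-identityʳ a)) (trans repeat (cong w (sym (+-identityʳ b))))
    outer-late (suc j) rewrite m+n∸m≡n a (suc j) = refl

    outer-late-suc : ∀ j → outer (suc (a + j)) ≡ w (suc (b + j))
    outer-late-suc j = trans (cong outer (sym (+-suc a j))) (trans (outer-late (suc j)) (cong w (+-suc b j)))

    inner-closed : ClosedWalk m inner
    inner-closed =
      (λ k k<m → subst (Adj G (w (a + k)) ∘ w) (sym (+-suc a k))
                   (proj₁ walk (a + k) (≤-trans (+-monoʳ-< a k<m) (m≤m+n b s))))
      , trans (cong w (+-identityʳ a)) repeat

    outer-closed : ClosedWalk (a + s) outer
    outer-closed = steps , trans (outer-early 0 z≤n) (trans (proj₂ walk) (sym (outer-late s)))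
      where
      steps : ∀ k → k < a + s → Adj G (outer k) (outer (suc k))
      steps k k<a+s with k <? a
      ... | yes k<a = subst₂ (Adj G) (sym (outer-early k (<⇒≤ k<a))) (sym (outer-early (suc k) k<a))
                        (proj₁ walk k (≤-trans k<a (≤-trans (m≤m+n a m) (m≤m+n b s))))
      ... | no k≮a = subst (λ z → Adj G (outer z) (outer (suc z))) (m+[n∸m]≡n a≤k)
                       (subst₂ (Adj G) (sym (outer-late j)) (sym (outer-late-suc j))
                          (proj₁ walk (b + j) (+-monoʳ-< b j<s)))
        where
        a≤k = ≮⇒≥ k≮a
        j = k ∸ a
        j<s : j < s
        j<s = +-cancelˡ-< a _ _ (subst (_< a + s) (sym (m+[n∸m]≡n a≤k)) k<a+s)

    parity-split : parityOf w ((a + m) + s) ≡ parityOf inner m xor parityOf outer (a + s)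
    parity-split = begin
      parityOf w ((a + m) + s)   ≡⟨ xorSum-+ f b s ⟩
      parityOf w b xor Z         ≡⟨ cong (_xor Z) (xorSum-+ f a m) ⟩
      (X xor Y) xor Z            ≡⟨ xor-middle X Y Z ⟩
      Y xor (X xor Z)            ≡⟨ cong₂ _xor_ inner-parity outer-parity ⟨
      parityOf inner m xor parityOf outer (a + s) ∎
      where
      open ≡-Reasoning
      f = λ k → μ (w k) (w (suc k))
      X = xorSum f a
      Y = xorSum (λ k → f (a + k)) m
      Z = xorSum (λ k → f (b + k)) s
      inner-parity : parityOf inner m ≡ Y
      inner-parity = xorSum-cong m (λ k _ → cong (μ (w (a + k)) ∘ w) (+-suc a k))
      outer-parity : parityOf outer (a + s) ≡ X xor Z
      outer-parity = trans (xorSum-+ _ a s) (cong₂ _xor_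
        (xorSum-cong a (λ k k<a → cong₂ μ (outer-early k (<⇒≤ k<a)) (outer-early (suc k) k<a)))
        (xorSum-cong s (λ j _ → cong₂ μ (outer-late j) (outer-late-suc j))))

  -- Simple closed walks have even parity if cycles do: there is none of
  -- length 1, and one of length 2 crosses a single edge twice.
  simple-walks-even : (∀ L w → 3 ≤ L → ClosedWalk L w → Simple L w → parityOf w L ≡ false) →
    ∀ L w → ClosedWalk L w → Simple L w → parityOf w L ≡ false
  simple-walks-even cycles-even 0 w _ _ = refl
  simple-walks-even cycles-even 1 w (steps , closed) _ = ⊥-elim (adj⇒≢ (steps 0 (s≤s z≤n)) closed)
  simple-walks-even cycles-even 2 w (_ , closed) _ = begin
    μ (w 0) (w 1) xor (μ (w 1) (w 2) xor false) ≡⟨ cong (μ (w 0) (w 1) xor_) (xor-identityʳ _) ⟩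
    μ (w 0) (w 1) xor μ (w 1) (w 2)             ≡⟨ cong (μ (w 0) (w 1) xor_) back ⟩
    μ (w 0) (w 1) xor μ (w 0) (w 1)             ≡⟨ xor-same (μ (w 0) (w 1)) ⟩
    false                                       ∎
    where
    open ≡-Reasoning
    back : μ (w 1) (w 2) ≡ μ (w 0) (w 1)
    back = trans (cong (μ (w 1)) (sym closed)) (μ-sym (w 1) (w 0))
  simple-walks-even cycles-even (suc (suc (suc L))) w walk simple =
    cycles-even _ w (s≤s (s≤s (s≤s z≤n))) walk simple

  -- If the parity is even on every cycle (simple closed walk of length at
  -- least 3) it is even on every closed walk: by strong induction on the
  -- length, cutting at a repeated vertex.
  closed-walks-even : (∀ L w → 3 ≤ L → ClosedWalk L w → Simple L w → parityOf w L ≡ false) →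
    ∀ L w → ClosedWalk L w → parityOf w L ≡ false
  closed-walks-even cycles-even = <-rec EvenOfLength even
    where
    EvenOfLength : ℕ → Set
    EvenOfLength L = ∀ w → ClosedWalk L w → parityOf w L ≡ false

    cut-even : ∀ {L} a m s → L ≡ (a + m) + s → 1 ≤ m → 1 ≤ s → (∀ {L′} → L′ < L → EvenOfLength L′) →
      ∀ w → ClosedWalk L w → w a ≡ w (a + m) → parityOf w L ≡ false
    cut-even a m s refl m≥1 s≥1 ih w walk repeat = trans parity-split
      (cong₂ _xor_ (ih (≤-<-trans (m≤n+m m a) (m<m+n (a + m) s≥1)) inner inner-closed)
                   (ih (+-monoˡ-< s (m<m+n a m≥1)) outer outer-closed))
      where open Cut a m s w walk repeat

    even : ∀ L → (∀ {L′} → L′ < L → EvenOfLength L′) → EvenOfLength L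
    even L ih w walk with repeat-or-simple L w
    ... | inj₂ simple = simple-walks-even cycles-even L w walk simple
    ... | inj₁ (a , b , a<b , b<L , repeat) =
      cut-even a (b ∸ a) (L ∸ b) L-split (m<n⇒0<n∸m a<b) (m<n⇒0<n∸m b<L) ih w walk
        (trans repeat (cong w (sym a+[b∸a])))
      where
      a+[b∸a] : a + (b ∸ a) ≡ b
      a+[b∸a] = m+[n∸m]≡n (<⇒≤ a<b)
      L-split : L ≡ (a + (b ∸ a)) + (L ∸ b)
      L-split = trans (sym (m+[n∸m]≡n (<⇒≤ b<L))) (cong (_+ (L ∸ b)) (sym a+[b∸a]))

  pathParity : ∀ {u v} → Reach G u v → Bool
  pathParity here = false
  pathParity (step {u} {x} _ r) = μ u x xor pathParity r

  _++ᴿ_ : ∀ {u v x} → Reach G u v → Reach G v x → Reach G u x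
  here ++ᴿ r′ = r′
  step ux r ++ᴿ r′ = step ux (r ++ᴿ r′)

  pathParity-++ : ∀ {u v x} (r : Reach G u v) (r′ : Reach G v x) →
    pathParity (r ++ᴿ r′) ≡ pathParity r xor pathParity r′
  pathParity-++ here r′ = refl
  pathParity-++ (step {u} {y} _ r) r′ =
    trans (cong (μ u y xor_) (pathParity-++ r r′)) (sym (xor-assoc (μ u y) _ _))

  reverseᴿ : ∀ {u v} → Reach G u v → Reach G v u
  reverseᴿ here = here
  reverseᴿ (step ux r) = reverseᴿ r ++ᴿ step (adj-sym ux) here

  pathParity-reverse : ∀ {u v} (r : Reach G u v) → pathParity (reverseᴿ r) ≡ pathParity r
  pathParity-reverse here = refl
  pathParity-reverse (step {u} {x} ux r) = begin
    pathParity (reverseᴿ r ++ᴿ step (adj-sym ux) here) ≡⟨ pathParity-++ (reverseᴿ r) _ ⟩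
    pathParity (reverseᴿ r) xor (μ x u xor false)    ≡⟨ cong₂ _xor_ (pathParity-reverse r) (xor-identityʳ _) ⟩
    pathParity r xor μ x u                            ≡⟨ cong (pathParity r xor_) (μ-sym x u) ⟩
    pathParity r xor μ u x                            ≡⟨ xor-comm (pathParity r) (μ u x) ⟩
    μ u x xor pathParity r                            ∎
    where open ≡-Reasoning

  pathLength : ∀ {u v} → Reach G u v → ℕ
  pathLength here = 0
  pathLength (step _ r) = suc (pathLength r)

  pathVertex : ∀ {u v} → Reach G u v → ℕ → Fin n
  pathVertex {u} here _ = u
  pathVertex {u} (step _ r) zero = u
  pathVertex (step _ r) (suc k) = pathVertex r k

  pathVertex-start : ∀ {u v} (r : Reach G u v) → pathVertex r 0 ≡ u
  pathVertex-start here = refl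
  pathVertex-start (step _ r) = refl

  pathVertex-end : ∀ {u v} (r : Reach G u v) → pathVertex r (pathLength r) ≡ v
  pathVertex-end here = refl
  pathVertex-end (step _ r) = pathVertex-end r

  pathVertex-steps : ∀ {u v} (r : Reach G u v) → ∀ k → k < pathLength r →
    Adj G (pathVertex r k) (pathVertex r (suc k))
  pathVertex-steps (step {u} ux r) zero _ = subst (Adj G u) (sym (pathVertex-start r)) ux
  pathVertex-steps (step _ r) (suc k) (s≤s k<) = pathVertex-steps r k k<

  pathParity-walk : ∀ {u v} (r : Reach G u v) → parityOf (pathVertex r) (pathLength r) ≡ pathParity r
  pathParity-walk here = refl
  pathParity-walk (step {u} _ r) = cong₂ _xor_ (cong (μ u) (pathVertex-start r)) (pathParity-walk r)

  closed-path-even : (∀ L w → ClosedWalk L w → parityOf w L ≡ false) →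
    ∀ {u} (r : Reach G u u) → pathParity r ≡ false
  closed-path-even walks-even r = trans (sym (pathParity-walk r))
    (walks-even _ _ (pathVertex-steps r , trans (pathVertex-start r) (sym (pathVertex-end r))))

-- In a connected graph in which every closed walk has even μ-parity, μ is
-- the edge difference of a vertex 2-colouring: colour each vertex by the
-- parity of a path from a fixed root.
balanced-colouring : ∀ {n} (G : Graph n) (μ : Fin n → Fin n → Bool) (μ-sym : ∀ a b → μ a b ≡ μ b a) →
  Connected G → (∀ L w → Walks.ClosedWalk G L w → WalkParity.parityOf G μ μ-sym w L ≡ false) →
  Σ (Fin n → Bool) λ col → ∀ {u v} → Adj G u v → col u xor col v ≡ μ u v
balanced-colouring {zero} G μ μ-sym _ _ = (λ ()) , λ { {()} }
balanced-colouring {suc n} G μ μ-sym connected walks-even = col , difference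
  where
  open WalkParity G μ μ-sym
  col : Fin (suc n) → Bool
  col v = pathParity (connected fzero v)
  difference : ∀ {u v} → Adj G u v → col u xor col v ≡ μ u v
  difference {u} {v} uv = xor-solve (col u) (μ u v) (col v) (begin
    col u xor (μ u v xor col v)     ≡⟨ cong (λ z → col u xor (μ u v xor z)) (pathParity-reverse (connected fzero v)) ⟨
    pathParity (connected fzero u) xor pathParity (step uv (reverseᴿ (connected fzero v)))
                                     ≡⟨ pathParity-++ (connected fzero u) _ ⟨
    pathParity (connected fzero u ++ᴿ step uv (reverseᴿ (connected fzero v)))
                                     ≡⟨ closed-path-even walks-even (connected fzero u ++ᴿ step uv (reverseᴿ (connected fzero v))) ⟩
    false                            ∎)
    where open ≡-Reasoning

module UpperBound {n : ℕ} (G : Graph n) (cactus : Cactus G) (m : ℕ) (oc : OddCycleCount G m) where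
  open CycleFacts G
  open Walks G

  c : Fin m → Cycle G
  c = proj₁ oc

  c-odd : ∀ i → Odd (len (c i))
  c-odd = proj₁ (proj₂ oc)

  c-distinct : ∀ i j → SameCycle (c i) (c j) → i ≡ j
  c-distinct = proj₁ (proj₂ (proj₂ oc))

  c-complete : ∀ (d : Cycle G) → Odd (len d) → ∃[ i ] SameCycle d (c i)
  c-complete = proj₂ (proj₂ (proj₂ oc))

  -- the edge removed from c i is the one leaving its first position
  first : (i : Fin m) → Fin (len (c i))
  first i = fromℕ< (≤-trans (s≤s z≤n) (len≥3 (c i)))

  cut₁ cut₂ : Fin m → Fin n
  cut₁ i = vtx (c i) (first i)
  cut₂ i = vtx (c i) (next (first i))

  cut-adj : ∀ i → Adj G (cut₁ i) (cut₂ i)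
  cut-adj i = closed (c i) _ _ (Next-next (first i))

  cut-edge : ∀ i → EdgeOf (c i) (cut₁ i) (cut₂ i)
  cut-edge i = edgeAt (c i) (first i)

  Removed : Fin n → Fin n → Set
  Removed a b = ∃[ i ] SamePair a b (cut₁ i) (cut₂ i)

  removed? : ∀ a b → Dec (Removed a b)
  removed? a b = any? λ i → ((a ≟ᶠ cut₁ i) ×-dec (b ≟ᶠ cut₂ i)) ⊎-dec ((a ≟ᶠ cut₂ i) ×-dec (b ≟ᶠ cut₁ i))

  marked : Fin n → Fin n → Bool
  marked a b with removed? a b
  ... | yes _ = false
  ... | no _ = true

  removed⇒unmarked : ∀ {a b} → Removed a b → marked a b ≡ false
  removed⇒unmarked {a} {b} r with removed? a b
  ... | yes _ = refl
  ... | no ¬r = ⊥-elim (¬r r)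

  kept⇒marked : ∀ {a b} → ¬ Removed a b → marked a b ≡ true
  kept⇒marked {a} {b} ¬r with removed? a b
  ... | yes r = ⊥-elim (¬r r)
  ... | no _ = refl

  unmarked⇒removed : ∀ {a b} → marked a b ≡ false → Removed a b
  unmarked⇒removed {a} {b} eq with removed? a b
  ... | yes r = r
  ... | no _ with eq
  ... | ()

  marked-sym : ∀ a b → marked a b ≡ marked b a
  marked-sym a b with removed? a b | removed? b a
  ... | yes _ | yes _ = refl
  ... | no _ | no _ = refl
  ... | yes (i , r) | no ¬r = ⊥-elim (¬r (i , SamePair-swap r))
  ... | no ¬r | yes (i , r) = ⊥-elim (¬r (i , SamePair-swap r))

  open WalkParity G marked marked-sym

  module _ (L : ℕ) (w : ℕ → Fin n) (L≥3 : 3 ≤ L) (walk : ClosedWalk L w) (simple : Simple L w) where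
    open AsCycle L w L≥3 walk simple

    -- A cycle avoiding all removed edges is even: an odd one is some c i
    -- and so contains the removed edge of c i.
    intact-even : (∀ k → k < L → marked (w k) (w (suc k)) ≡ true) → parity L ≡ false
    intact-even all-marked with parity L in odd
    ... | false = refl
    ... | true with c-complete cycle (parity⇒Odd L odd)
    ... | i , same with proj₂ (same (cut₁ i) (cut₂ i)) (cut-edge i)
    ... | p , q , p↦q , at-p with all-marked (toℕ p) (toℕ<n p)
      | removed⇒unmarked (i , SamePair-trans (inj₁ (refl , sym (after p↦q))) at-p)
    ... | marked≡true | marked≡false = ⊥-elim (not-¬ refl (trans (sym marked≡false) marked≡true))

    -- A cycle through the removed edge of c j is c j, which contains no
    -- other removed edge; so it has odd length and one unmarked edge.
    broken-once-even : ∀ {k₀} j → k₀ < L → SamePair (w k₀) (w (suc k₀)) (cut₁ j) (cut₂ j) →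
      SameCycle cycle (c j) → parityOf w L ≡ false
    broken-once-even {k₀} j k₀<L at-k₀ same = begin
      parityOf w L       ≡⟨ xorSum-oneFalse L k₀ k₀<L (removed⇒unmarked (j , at-k₀)) only-at-k₀ ⟩
      not (parity L)     ≡⟨ cong (not ∘ parity) (SameCycle-len cycle (c j) same) ⟩
      not (parity (len (c j))) ≡⟨ cong not (Odd⇒parity (c-odd j)) ⟩
      false              ∎
      where
      open ≡-Reasoning
      only-at-k₀ : ∀ k → k < L → k ≢ k₀ → marked (w k) (w (suc k)) ≡ true
      only-at-k₀ k k<L k≢k₀ with marked (w k) (w (suc k)) in unmarked
      ... | true = refl
      ... | false with unmarked⇒removed unmarked
      ... | j′ , at-k = ⊥-elim (share-edge cactus (c j) (c j′) (cut-adj j′)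
              (proj₁ (same (cut₁ j′) (cut₂ j′)) (step-edge k<L at-k)) (cut-edge j′)
              λ same′ → k≢k₀ (same-position (c-distinct j j′ same′)))
        where
        same-position : j ≡ j′ → k ≡ k₀
        same-position refl = trans (sym (toℕ-fromℕ< k<L)) (trans (cong toℕ positions) (toℕ-fromℕ< k₀<L))
          where
          positions : fromℕ< k<L ≡ fromℕ< k₀<L
          positions = edge-position cycle (Next-next _) (Next-next _)
            (SamePair-trans (edge-at k<L) (SamePair-trans at-k (SamePair-trans (SamePair-sym at-k₀)
              (SamePair-sym (edge-at k₀<L)))))

    cycle-even : parityOf w L ≡ false
    cycle-even with anyUpTo? (λ k → marked (w k) (w (suc k)) ≟ᴮ false) L
    ... | no none = trans (xorSum-true L all-marked) (intact-even all-marked)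
      where
      all-marked : ∀ k → k < L → marked (w k) (w (suc k)) ≡ true
      all-marked k k<L with marked (w k) (w (suc k)) in eq
      ... | true = refl
      ... | false = ⊥-elim (none (k , k<L , eq))
    ... | yes (k₀ , k₀<L , unmarked) with unmarked⇒removed unmarked
    ... | j , at-k₀ = decidable-stable (parityOf w L ≟ᴮ false) λ odd →
      share-edge cactus cycle (c j) (cut-adj j) (step-edge k₀<L at-k₀) (cut-edge j)
        (odd ∘ broken-once-even j k₀<L at-k₀)

  colouring : Σ (Fin n → Bool) λ col → ∀ {u v} → Adj G u v → col u xor col v ≡ marked u v
  colouring = balanced-colouring G marked marked-sym (proj₁ cactus) (closed-walks-even cycle-even)

  open ColourIASI G (proj₁ colouring) public

  removed⇒¬PrimeRatio : ∀ {u v} → Adj G u v → Removed u v → ¬ PrimeRatio F u v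
  removed⇒¬PrimeRatio uv r = same⇒¬PrimeRatio (xor-false⇒≡ (trans (proj₂ colouring uv) (removed⇒unmarked r)))

  kept⇒PrimeRatio : ∀ {u v} → Adj G u v → ¬ Removed u v → PrimeRatio F u v
  kept⇒PrimeRatio uv ¬r = differ⇒PrimeRatio (xor-true⇒not (trans (proj₂ colouring uv) (kept⇒marked ¬r)))

  upper-bound : NonPrimeCount F m
  upper-bound = e , (λ i → orient-IsEdge G (cut-adj i) ,
                      orient-¬PrimeRatio F (removed⇒¬PrimeRatio (cut-adj i) (i , inj₁ (refl , refl))))
              , e-injective , e-complete
    where
    e : Fin m → Fin n × Fin n
    e i = orient (cut₁ i) (cut₂ i)
    e-injective : ∀ i j → e i ≡ e j → i ≡ j
    e-injective i j eq = decidable-stable (i ≟ᶠ j) λ i≢j →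
      share-edge cactus (c i) (c j) (cut-adj i) (cut-edge i)
        (EdgeOf-SamePair (c j) (SamePair-sym (orient-injective eq)) (cut-edge j))
        (i≢j ∘ c-distinct i j)
    e-complete : ∀ uv → IsEdge G uv → ¬ PrimeRatio F (proj₁ uv) (proj₂ uv) → ∃[ i ] e i ≡ uv
    e-complete (u , v) (u<v , uv) ¬pr with removed? u v
    ... | yes (i , r) = i , orient-ordered u<v (SamePair-sym r)
    ... | no ¬r = ⊥-elim (¬pr (kept⇒PrimeRatio uv ¬r))

theorem3p8 : ∀ (n : ℕ) (G : Graph n) → Cactus G →
    ∀ (m : ℕ) → OddCycleCount G m → DispensingNumber G m
theorem3p8 n G cactus m oc = (F , upper-bound) , lower-bound m oc
  where
  open UpperBound G cactus m oc
  open LowerBound G cactus
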